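{- Let $(H,wt)$ be a weighted graph. For each $a\in V(H)$ take a copy of the edge-coloured digraph $C_{wt(a)}$ and fix a vertex $v(a)$ of it. Let $G$ be the disjoint union of these copies together with, for each edge $ab$ of $H$, a dashed edge between $v(a)$ and $v(b)$. Then $X_{(H,wt)}(x)=\mathscr{X}_G(x)$.
   Context: A weighted graph is a finite simple graph $H$ with $wt:V(H)\to\mathbb{P}$. Its extended chromatic symmetric function is $X_{(H,wt)}(x)=\sum_\kappa\prod_{a\in V(H)}x_{\kappa(a)}^{wt(a)}$, the sum over all $\kappa:V(H)\to\mathbb{P}$ with $\kappa(a)\ne\kappa(b)$ for adjacent $a,b$. An edge-coloured digraph is a finite digraph without loops, with at most one edge from $a$ to $b$ for distinct $a,b$, each edge being dashed ($\dashrightarrow$), solid ($\rightarrow$) or double ($\Rightarrow$). A proper vertex-colouring is $\kappa:V(G)\to\mathbb{P}$ with $\kappa(a)\ne\kappa(b)$ if $a\dashrightarrow b$, $\kappa(a)<\kappa(b)$ if $a\rightarrow b$, $\kappa(a)\le\kappa(b)$ if $a\Rightarrow b$; $\mathscr{X}_G(x)=\sum_\kappa\prod_{a\in V(G)}x_{\kappa(a)}$ over proper vertex-colourings. $C_n$ is the directed cycle on vertices $a_1,\dots,a_n$ with double edges $a_i\Rightarrow a_{i+1}$ ($1\le i<n$) and $a_n\Rightarrow a_1$ (for $n=1$, a single vertex, any loop imposing no condition). The orientation of the dashed edges is immaterial. -}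

module Defs where

open import Data.Nat as ℕ using (ℕ; zero; suc; _+_)
open import Data.Bool using (Bool; true; false; if_then_else_)
open import Data.Fin as Fin using (Fin; zero; suc; toℕ; splitAt)
open import Data.Fin.Properties using (_≟_; all?)
open import Data.Sum using (_⊎_; inj₁; inj₂)
open import Data.Product using (Σ; _,_; _×_; proj₁; proj₂)
open import Data.Maybe using (Maybe; just; nothing)
open import Data.Unit using (⊤; tt)
open import Data.List using (List; []; _∷_; map; concatMap; length; filter)
open import Data.Vec.Functional using () renaming (_∷_ to _∷ᶠ_)
open import Relation.Nullary using (Dec; yes; no; ¬_; does)
open import Relation.Nullary.Decidable using (_×-dec_; ¬?)
open import Relation.Binary.PropositionalEquality using (_≡_; _≢_; refl)

sumFin : (n : ℕ) → (Fin n → ℕ) → ℕ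
sumFin zero    f = 0
sumFin (suc n) f = f zero + sumFin n (λ i → f (suc i))

allFin : (m : ℕ) → List (Fin m)
allFin zero    = []
allFin (suc m) = zero ∷ map suc (allFin m)

-- every function Fin N → Fin m occurs exactly once (up to pointwise equality)
allMaps : (N m : ℕ) → List (Fin N → Fin m)
allMaps zero    m = (λ ()) ∷ []
allMaps (suc N) m = concatMap (λ c → map (λ f → c ∷ᶠ f) (allMaps N m)) (allFin m)

countMaps : (N m : ℕ) {P : (Fin N → Fin m) → Set} →
            ((κ : Fin N → Fin m) → Dec (P κ)) → ℕ
countMaps N m P? = length (filter P? (allMaps N m))

-- Colours: Fin m, where the colour i : Fin m stands for the positive
-- integer (toℕ i + 1); the order on Fin m is the order on ℙ.
-- A monomial x₁^{α₁} ⋯ x_m^{α_m} is an exponent vector α : Fin m → ℕ.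

record WeightedGraph : Set where
  field
    n     : ℕ
    adj   : Fin n → Fin n → Bool
    sym   : ∀ a b → adj a b ≡ adj b a
    irrefl : ∀ a → adj a a ≡ false
    wt    : Fin n → ℕ
    wt-pos : ∀ a → 1 ℕ.≤ wt a

open WeightedGraph public

ProperW : (H : WeightedGraph) {m : ℕ} → (Fin (n H) → Fin m) → Set
ProperW H κ = ∀ a b → adj H a b ≡ true → κ a ≢ κ b

-- exponent of x_i in ∏_a x_{κ(a)}^{wt(a)}
wexp : (H : WeightedGraph) {m : ℕ} → (Fin (n H) → Fin m) → Fin m → ℕ
wexp H κ i = sumFin (n H) (λ a → if does (κ a ≟ i) then wt H a else 0)

private
  adj? : (H : WeightedGraph) (a b : Fin (n H)) → Dec (adj H a b ≡ true)
  adj? H a b with adj H a b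
  ... | true  = yes refl
  ... | false = no (λ ())

  impl? : {A B : Set} → Dec A → Dec B → Dec (A → B)
  impl? _       (yes b) = yes (λ _ → b)
  impl? (no ¬a) (no _)  = yes (λ a → Data.Empty.⊥-elim (¬a a))
    where import Data.Empty
  impl? (yes a) (no ¬b) = no (λ f → ¬b (f a))

  ℕ≟ = Data.Nat._≟_
    where import Data.Nat

ProperW? : (H : WeightedGraph) {m : ℕ} (κ : Fin (n H) → Fin m) → Dec (ProperW H κ)
ProperW? H κ = all? (λ a → all? (λ b → impl? (adj? H a b) (¬? (κ a ≟ κ b))))

-- coefficient of x₁^{α₁} ⋯ x_m^{α_m} in X_{(H,wt)}(x)
coeffX : (H : WeightedGraph) (m : ℕ) (α : Fin m → ℕ) → ℕ
coeffX H m α =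
  countMaps (n H) m (λ κ → ProperW? H κ ×-dec all? (λ i → ℕ≟ (wexp H κ i) (α i)))

data EdgeKind : Set where
  dashed solid double : EdgeKind

record ECDigraph : Set where
  field
    N      : ℕ
    edge   : Fin N → Fin N → Maybe EdgeKind
    noLoop : ∀ a → edge a a ≡ nothing

open ECDigraph public

EdgeOK : {m : ℕ} → Maybe EdgeKind → Fin m → Fin m → Set
EdgeOK nothing       c d = ⊤
EdgeOK (just dashed) c d = c ≢ d
EdgeOK (just solid)  c d = c Fin.< d
EdgeOK (just double) c d = c Fin.≤ d

EdgeOK? : {m : ℕ} (e : Maybe EdgeKind) (c d : Fin m) → Dec (EdgeOK e c d)
EdgeOK? nothing       c d = yes tt
EdgeOK? (just dashed) c d = ¬? (c ≟ d)
EdgeOK? (just solid)  c d = c Data.Fin.Properties.<? d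
  where import Data.Fin.Properties
EdgeOK? (just double) c d = c Data.Fin.Properties.≤? d
  where import Data.Fin.Properties

ProperD : (G : ECDigraph) {m : ℕ} → (Fin (N G) → Fin m) → Set
ProperD G κ = ∀ a b → EdgeOK (edge G a b) (κ a) (κ b)

ProperD? : (G : ECDigraph) {m : ℕ} (κ : Fin (N G) → Fin m) → Dec (ProperD G κ)
ProperD? G κ = all? (λ a → all? (λ b → EdgeOK? (edge G a b) (κ a) (κ b)))

-- exponent of x_i in ∏_a x_{κ(a)}
dexp : (G : ECDigraph) {m : ℕ} → (Fin (N G) → Fin m) → Fin m → ℕ
dexp G κ i = sumFin (N G) (λ a → if does (κ a ≟ i) then 1 else 0)

-- coefficient of x₁^{α₁} ⋯ x_m^{α_m} in 𝒳_G(x)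
coeff𝒳 : (G : ECDigraph) (m : ℕ) (α : Fin m → ℕ) → ℕ
coeff𝒳 G m α =
  countMaps (N G) m (λ κ → ProperD? G κ ×-dec all? (λ i → ℕ≟ (dexp G κ i) (α i)))

-- The directed cycle C_k on vertices a₁,…,a_k (here zero,…,k-1):
-- double edges a_i ⇒ a_{i+1} and a_k ⇒ a₁; no loop when k = 1.

cycEdge : (k : ℕ) → Fin k → Fin k → Maybe EdgeKind
cycEdge k i j with i ≟ j
... | yes _ = nothing
... | no  _ with ℕ≟ (suc (toℕ i)) (toℕ j) | ℕ≟ (suc (toℕ i)) k | ℕ≟ (toℕ j) 0
...   | yes _ | _     | _     = just double
...   | no  _ | yes _ | yes _ = just double
...   | no  _ | _     | _     = nothing

cycNoLoop : (k : ℕ) (i : Fin k) → cycEdge k i i ≡ nothing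
cycNoLoop k i with i ≟ i
... | yes _ = refl
... | no ne = Data.Empty.⊥-elim (ne refl)
  where import Data.Empty

C : ℕ → ECDigraph
C k = record { N = k ; edge = cycEdge k ; noLoop = cycNoLoop k }

-- The digraph G built from (H,wt) and a choice of vertices v(a) of C_{wt(a)}.
-- Vertex set: the disjoint union ⊔_a Fin (wt a), listed block by block
-- as Fin (wt 0 + wt 1 + ⋯ + wt (n-1)).

blockSize : (k : ℕ) → (Fin k → ℕ) → ℕ
blockSize = sumFin

decode : (k : ℕ) (w : Fin k → ℕ) → Fin (blockSize k w) → Σ (Fin k) (λ a → Fin (w a))
decode zero    w ()
decode (suc k) w x with splitAt (w zero) x
... | inj₁ i = zero , i
... | inj₂ y with decode k (λ a → w (suc a)) y
...   | a , j = suc a , j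

private
  unionEdge : (H : WeightedGraph) (v : (a : Fin (n H)) → Fin (wt H a)) →
              (p q : Σ (Fin (n H)) (λ a → Fin (wt H a))) → Maybe EdgeKind
  unionEdge H v (a , i) (b , j) with a ≟ b
  ... | yes refl = cycEdge (wt H a) i j
  ... | no _ with adj H a b | a Data.Fin.Properties.<? b | i ≟ v a | j ≟ v b
    where import Data.Fin.Properties
  ...   | true | yes _ | yes _ | yes _ = just dashed
  ...   | _    | _     | _     | _     = nothing

  unionNoLoop : (H : WeightedGraph) (v : (a : Fin (n H)) → Fin (wt H a)) →
                (p : Σ (Fin (n H)) (λ a → Fin (wt H a))) → unionEdge H v p p ≡ nothing
  unionNoLoop H v (a , i) with a ≟ a
  ... | yes refl = cycNoLoop (wt H a) i
  ... | no ne = Data.Empty.⊥-elim (ne refl)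
    where import Data.Empty

GOf : (H : WeightedGraph) (v : (a : Fin (n H)) → Fin (wt H a)) → ECDigraph
GOf H v = record
  { N      = blockSize (n H) (wt H)
  ; edge   = λ x y → unionEdge H v (decode (n H) (wt H) x) (decode (n H) (wt H) y)
  ; noLoop = λ x → unionNoLoop H v (decode (n H) (wt H) x)
  }

-- Every proper colouring of G is constant on each copy of C_{wt(a)}, because the double
-- edges around a cycle force its colours to be weakly increasing all the way round.  So
-- the proper colourings of G are exactly the colourings of H spread over the copies,
-- with v(a) carrying the colour of a; the dashed edges then say precisely that the
-- colouring of H is proper, and a block of size wt(a) contributes x^{wt(a)}.
module Submission where

open import Defs
open import Data.Nat using (ℕ)
open import Data.Fin using (Fin)
open import Relation.Binary.PropositionalEquality using (_≡_)

open import Data.Nat using (zero; suc; _+_; _*_)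
import Data.Nat.Properties as ℕₚ
open import Data.Bool using (Bool; true; false; if_then_else_)
open import Data.Fin using (zero; suc; toℕ; splitAt; _↑ˡ_; _↑ʳ_; inject₁; fromℕ; _≤_; _<_)
import Data.Fin.Properties as Finₚ
open import Data.Fin.Properties using (_≟_; all?)
open import Data.Sum using (_⊎_; inj₁; inj₂)
open import Data.Product using (_,_; _×_; proj₁; proj₂)
open import Data.Maybe using (just)
open import Data.Unit using (tt)
open import Data.Empty using (⊥-elim)
open import Data.List using (List; []; _∷_; map; concatMap; length; filter; _++_)
open import Data.Vec.Functional using () renaming (_∷_ to _∷ᶠ_)
open import Relation.Nullary using (Dec; yes; no; ¬_; does)
open import Relation.Nullary.Decidable using (_×-dec_)
import Relation.Binary.PropositionalEquality as ≡
open import Relation.Binary.PropositionalEquality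
  using (_≢_; _≗_; refl; trans; cong; cong₂; subst; subst₂; module ≡-Reasoning)
open import Relation.Binary using (tri<; tri≈; tri>)
open import Algebra.Properties.CommutativeSemigroup ℕₚ.+-commutativeSemigroup
  using () renaming (interchange to +-interchange)

open ≡-Reasoning


sumOver : {A : Set} → List A → (A → ℕ) → ℕ
sumOver []       h = 0
sumOver (x ∷ xs) h = h x + sumOver xs h

sumOver-cong : {A : Set} (xs : List A) {h h′ : A → ℕ} → h ≗ h′ → sumOver xs h ≡ sumOver xs h′
sumOver-cong []       e = refl
sumOver-cong (x ∷ xs) e = cong₂ _+_ (e x) (sumOver-cong xs e)

sumOver-zero : {A : Set} (xs : List A) → sumOver xs (λ _ → 0) ≡ 0
sumOver-zero []       = refl
sumOver-zero (x ∷ xs) = sumOver-zero xs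

sumOver-++ : {A : Set} (xs ys : List A) (h : A → ℕ) →
             sumOver (xs ++ ys) h ≡ sumOver xs h + sumOver ys h
sumOver-++ []       ys h = refl
sumOver-++ (x ∷ xs) ys h = trans (cong (h x +_) (sumOver-++ xs ys h)) (≡.sym (ℕₚ.+-assoc (h x) _ _))

sumOver-map : {A B : Set} (f : A → B) (xs : List A) (h : B → ℕ) →
              sumOver (map f xs) h ≡ sumOver xs (λ x → h (f x))
sumOver-map f []       h = refl
sumOver-map f (x ∷ xs) h = cong (h (f x) +_) (sumOver-map f xs h)

sumOver-concatMap : {A B : Set} (f : A → List B) (xs : List A) (h : B → ℕ) →
                    sumOver (concatMap f xs) h ≡ sumOver xs (λ x → sumOver (f x) h)
sumOver-concatMap f []       h = refl
sumOver-concatMap f (x ∷ xs) h =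
  trans (sumOver-++ (f x) (concatMap f xs) h) (cong (sumOver (f x) h +_) (sumOver-concatMap f xs h))

sumOver-distrib-+ : {A : Set} (xs : List A) (f g : A → ℕ) →
                    sumOver xs (λ x → f x + g x) ≡ sumOver xs f + sumOver xs g
sumOver-distrib-+ []       f g = refl
sumOver-distrib-+ (x ∷ xs) f g =
  trans (cong (f x + g x +_) (sumOver-distrib-+ xs f g)) (+-interchange (f x) (g x) _ _)

sumOver-distribˡ-* : {A : Set} (c : ℕ) (xs : List A) (h : A → ℕ) →
                     sumOver xs (λ x → c * h x) ≡ c * sumOver xs h
sumOver-distribˡ-* c []       h = ≡.sym (ℕₚ.*-zeroʳ c)
sumOver-distribˡ-* c (x ∷ xs) h =
  trans (cong (c * h x +_) (sumOver-distribˡ-* c xs h)) (≡.sym (ℕₚ.*-distribˡ-+ c (h x) _))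

sumOver-comm : {A B : Set} (xs : List A) (ys : List B) (h : A → B → ℕ) →
               sumOver xs (λ x → sumOver ys (h x)) ≡ sumOver ys (λ y → sumOver xs (λ x → h x y))
sumOver-comm []       ys h = ≡.sym (sumOver-zero ys)
sumOver-comm (x ∷ xs) ys h =
  trans (cong (sumOver ys (h x) +_) (sumOver-comm xs ys h))
        (≡.sym (sumOver-distrib-+ ys (h x) (λ y → sumOver xs (λ x′ → h x′ y))))

𝟙 : {P : Set} → Dec P → ℕ
𝟙 (yes _) = 1
𝟙 (no _)  = 0

𝟙-yes : {P : Set} (d : Dec P) → P → 𝟙 d ≡ 1
𝟙-yes (yes _) p = refl
𝟙-yes (no ¬p) p = ⊥-elim (¬p p)

𝟙-no : {P : Set} (d : Dec P) → ¬ P → 𝟙 d ≡ 0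
𝟙-no (yes p) ¬p = ⊥-elim (¬p p)
𝟙-no (no _)  ¬p = refl

𝟙-⇔ : {P Q : Set} (p : Dec P) (q : Dec Q) → (P → Q) → (Q → P) → 𝟙 p ≡ 𝟙 q
𝟙-⇔ (yes p) q to from = ≡.sym (𝟙-yes q (to p))
𝟙-⇔ (no ¬p) q to from = ≡.sym (𝟙-no q (λ x → ¬p (from x)))

𝟙-×-dec : {P Q : Set} (p : Dec P) (q : Dec Q) → 𝟙 (p ×-dec q) ≡ 𝟙 p * 𝟙 q
𝟙-×-dec (yes _) (yes _) = refl
𝟙-×-dec (yes _) (no _)  = refl
𝟙-×-dec (no _)  q       = refl

length-filter≡sumOver-𝟙 : {A : Set} {P : A → Set} (P? : ∀ x → Dec (P x)) (xs : List A) →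
                          length (filter P? xs) ≡ sumOver xs (λ x → 𝟙 (P? x))
length-filter≡sumOver-𝟙 P? []       = refl
length-filter≡sumOver-𝟙 P? (x ∷ xs) with P? x
... | yes _ = cong suc (length-filter≡sumOver-𝟙 P? xs)
... | no _  = length-filter≡sumOver-𝟙 P? xs

_≗?_ : {N m : ℕ} (κ κ′ : Fin N → Fin m) → Dec (κ ≗ κ′)
κ ≗? κ′ = all? (λ i → κ i ≟ κ′ i)

allFin-unique : ∀ m (d : Fin m) → sumOver (allFin m) (λ c → 𝟙 (c ≟ d)) ≡ 1
allFin-unique (suc m) zero = begin
  𝟙 (zero ≟ zero {m}) + sumOver (map suc (allFin m)) (λ c → 𝟙 (c ≟ zero))
    ≡⟨ cong (1 +_) (sumOver-map suc (allFin m) _) ⟩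
  1 + sumOver (allFin m) (λ c → 𝟙 (suc c ≟ zero))
    ≡⟨ cong (1 +_) (trans (sumOver-cong (allFin m) (λ c → 𝟙-no (suc c ≟ zero) (λ ())))
                          (sumOver-zero (allFin m))) ⟩
  1 ∎
allFin-unique (suc m) (suc d) = begin
  𝟙 (zero ≟ suc d) + sumOver (map suc (allFin m)) (λ c → 𝟙 (c ≟ suc d))
    ≡⟨ sumOver-map suc (allFin m) _ ⟩
  sumOver (allFin m) (λ c → 𝟙 (suc c ≟ suc d))
    ≡⟨ sumOver-cong (allFin m) (λ c → 𝟙-⇔ (suc c ≟ suc d) (c ≟ d) Finₚ.suc-injective (cong suc)) ⟩
  sumOver (allFin m) (λ c → 𝟙 (c ≟ d))
    ≡⟨ allFin-unique m d ⟩
  1 ∎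

allMaps-unique : ∀ N m (z : Fin N → Fin m) → sumOver (allMaps N m) (λ κ → 𝟙 (κ ≗? z)) ≡ 1
allMaps-unique zero    m z = cong (_+ 0) (𝟙-yes ((λ ()) ≗? z) (λ ()))
allMaps-unique (suc N) m z = begin
  sumOver (allMaps (suc N) m) (λ κ → 𝟙 (κ ≗? z))
    ≡⟨ sumOver-concatMap (λ c → map (c ∷ᶠ_) (allMaps N m)) (allFin m) _ ⟩
  sumOver (allFin m) (λ c → sumOver (map (c ∷ᶠ_) (allMaps N m)) (λ κ → 𝟙 (κ ≗? z)))
    ≡⟨ sumOver-cong (allFin m) (λ c → sumOver-map (c ∷ᶠ_) (allMaps N m) _) ⟩
  sumOver (allFin m) (λ c → sumOver (allMaps N m) (λ κ → 𝟙 ((c ∷ᶠ κ) ≗? z)))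
    ≡⟨ sumOver-cong (allFin m) (λ c → sumOver-cong (allMaps N m) (λ κ → split c κ)) ⟩
  sumOver (allFin m) (λ c → sumOver (allMaps N m) (λ κ → 𝟙 (c ≟ z zero) * 𝟙 (κ ≗? z′)))
    ≡⟨ sumOver-cong (allFin m) (λ c → sumOver-distribˡ-* (𝟙 (c ≟ z zero)) (allMaps N m) _) ⟩
  sumOver (allFin m) (λ c → 𝟙 (c ≟ z zero) * sumOver (allMaps N m) (λ κ → 𝟙 (κ ≗? z′)))
    ≡⟨ sumOver-cong (allFin m) (λ c → trans (cong (𝟙 (c ≟ z zero) *_) (allMaps-unique N m z′))
                                            (ℕₚ.*-identityʳ _)) ⟩
  sumOver (allFin m) (λ c → 𝟙 (c ≟ z zero))
    ≡⟨ allFin-unique m (z zero) ⟩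
  1 ∎
  where
  z′ : Fin N → Fin _
  z′ i = z (suc i)
  split : ∀ c κ → 𝟙 ((c ∷ᶠ κ) ≗? z) ≡ 𝟙 (c ≟ z zero) * 𝟙 (κ ≗? z′)
  split c κ = trans (𝟙-⇔ ((c ∷ᶠ κ) ≗? z) ((c ≟ z zero) ×-dec (κ ≗? z′))
                      (λ e → e zero , λ i → e (suc i))
                      (λ { (e₀ , e) zero → e₀ ; (e₀ , e) (suc i) → e i }))
                    (𝟙-×-dec (c ≟ z zero) (κ ≗? z′))

-- Double counting: Σ_κ [P κ] = Σ_κ Σ_ν [P κ][ν ≗ f κ] = Σ_ν Σ_κ [P κ][ν ≗ f κ], and the
-- inner sum on the right is [Q ν] because, for Q ν, its only nonzero term is κ ≗ g ν.
module CountingByBijection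
  {N M m : ℕ}
  {P : (Fin N → Fin m) → Set} (P? : ∀ κ → Dec (P κ))
  {Q : (Fin M → Fin m) → Set} (Q? : ∀ ν → Dec (Q ν))
  (f : (Fin N → Fin m) → Fin M → Fin m) (g : (Fin M → Fin m) → Fin N → Fin m)
  (P-resp : ∀ {κ κ′} → κ ≗ κ′ → P κ → P κ′)
  (Q-resp : ∀ {ν ν′} → ν ≗ ν′ → Q ν → Q ν′)
  (f-cong : ∀ {κ κ′} → κ ≗ κ′ → f κ ≗ f κ′)
  (g-cong : ∀ {ν ν′} → ν ≗ ν′ → g ν ≗ g ν′)
  (f-maps : ∀ {κ} → P κ → Q (f κ))
  (g-maps : ∀ {ν} → Q ν → P (g ν))
  (g∘f : ∀ {κ} → P κ → g (f κ) ≗ κ)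
  (f∘g : ∀ {ν} → Q ν → f (g ν) ≗ ν)
  where

  private
    fibre : ∀ ν → sumOver (allMaps N m) (λ κ → 𝟙 (P? κ) * 𝟙 (ν ≗? f κ)) ≡ 𝟙 (Q? ν)
    fibre ν with Q? ν
    ... | yes q = trans (sumOver-cong (allMaps N m) onFibre) (allMaps-unique N m (g ν))
      where
      onFibre : ∀ κ → 𝟙 (P? κ) * 𝟙 (ν ≗? f κ) ≡ 𝟙 (κ ≗? g ν)
      onFibre κ = trans (≡.sym (𝟙-×-dec (P? κ) (ν ≗? f κ)))
        (𝟙-⇔ (P? κ ×-dec (ν ≗? f κ)) (κ ≗? g ν)
          (λ (p , e) x → trans (≡.sym (g∘f p x)) (≡.sym (g-cong e x)))
          (λ e → P-resp (λ x → ≡.sym (e x)) (g-maps q) ,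
                 λ y → trans (≡.sym (f∘g q y)) (≡.sym (f-cong e y))))
    ... | no ¬q = trans (sumOver-cong (allMaps N m) offFibre) (sumOver-zero (allMaps N m))
      where
      offFibre : ∀ κ → 𝟙 (P? κ) * 𝟙 (ν ≗? f κ) ≡ 0
      offFibre κ = trans (≡.sym (𝟙-×-dec (P? κ) (ν ≗? f κ)))
        (𝟙-no (P? κ ×-dec (ν ≗? f κ)) (λ (p , e) → ¬q (Q-resp (λ y → ≡.sym (e y)) (f-maps p))))

  countMaps-≡ : countMaps N m P? ≡ countMaps M m Q?
  countMaps-≡ = begin
    countMaps N m P?
      ≡⟨ length-filter≡sumOver-𝟙 P? (allMaps N m) ⟩
    sumOver (allMaps N m) (λ κ → 𝟙 (P? κ))
      ≡⟨ sumOver-cong (allMaps N m) (λ κ → trans (≡.sym (ℕₚ.*-identityʳ (𝟙 (P? κ))))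
                                                 (cong (𝟙 (P? κ) *_) (≡.sym (allMaps-unique M m (f κ))))) ⟩
    sumOver (allMaps N m) (λ κ → 𝟙 (P? κ) * sumOver (allMaps M m) (λ ν → 𝟙 (ν ≗? f κ)))
      ≡⟨ sumOver-cong (allMaps N m) (λ κ → ≡.sym (sumOver-distribˡ-* (𝟙 (P? κ)) (allMaps M m) _)) ⟩
    sumOver (allMaps N m) (λ κ → sumOver (allMaps M m) (λ ν → 𝟙 (P? κ) * 𝟙 (ν ≗? f κ)))
      ≡⟨ sumOver-comm (allMaps N m) (allMaps M m) _ ⟩
    sumOver (allMaps M m) (λ ν → sumOver (allMaps N m) (λ κ → 𝟙 (P? κ) * 𝟙 (ν ≗? f κ)))
      ≡⟨ sumOver-cong (allMaps M m) fibre ⟩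
    sumOver (allMaps M m) (λ ν → 𝟙 (Q? ν))
      ≡⟨ ≡.sym (length-filter≡sumOver-𝟙 Q? (allMaps M m)) ⟩
    countMaps M m Q? ∎

sumFin-cong : ∀ p {f g : Fin p → ℕ} → f ≗ g → sumFin p f ≡ sumFin p g
sumFin-cong zero    e = refl
sumFin-cong (suc p) e = cong₂ _+_ (e zero) (sumFin-cong p (λ i → e (suc i)))

sumFin-↑ : ∀ p q (f : Fin (p + q) → ℕ) →
           sumFin (p + q) f ≡ sumFin p (λ i → f (i ↑ˡ q)) + sumFin q (λ j → f (p ↑ʳ j))
sumFin-↑ zero    q f = refl
sumFin-↑ (suc p) q f =
  trans (cong (f zero +_) (sumFin-↑ p q (λ i → f (suc i)))) (≡.sym (ℕₚ.+-assoc (f zero) _ _))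

sumFin-indicator : ∀ p (b : Bool) → sumFin p (λ _ → if b then 1 else 0) ≡ (if b then p else 0)
sumFin-indicator zero    true  = refl
sumFin-indicator zero    false = refl
sumFin-indicator (suc p) true  = cong suc (sumFin-indicator p true)
sumFin-indicator (suc p) false = sumFin-indicator p false

encode : (k : ℕ) (w : Fin k → ℕ) (a : Fin k) → Fin (w a) → Fin (blockSize k w)
encode (suc k) w zero    i = i ↑ˡ blockSize k (λ a → w (suc a))
encode (suc k) w (suc a) i = w zero ↑ʳ encode k (λ a → w (suc a)) a i

decode-encode : (k : ℕ) (w : Fin k → ℕ) (a : Fin k) (i : Fin (w a)) →
                decode k w (encode k w a i) ≡ (a , i)
decode-encode (suc k) w zero i
  rewrite Finₚ.splitAt-↑ˡ (w zero) i (blockSize k (λ a → w (suc a))) = refl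
decode-encode (suc k) w (suc a) i
  rewrite Finₚ.splitAt-↑ʳ (w zero) (blockSize k (λ a → w (suc a))) (encode k (λ a → w (suc a)) a i)
        | decode-encode k (λ a → w (suc a)) a i = refl

encode-decode : (k : ℕ) (w : Fin k → ℕ) (x : Fin (blockSize k w)) →
                encode k w (proj₁ (decode k w x)) (proj₂ (decode k w x)) ≡ x
encode-decode (suc k) w x with splitAt (w zero) x in eq
... | inj₁ i = Finₚ.splitAt⁻¹-↑ˡ eq
... | inj₂ y with decode k (λ a → w (suc a)) y | encode-decode k (λ a → w (suc a)) y
...   | a , j | e = trans (cong (w zero ↑ʳ_) e) (Finₚ.splitAt⁻¹-↑ʳ eq)

sumFin-blocks : ∀ k (w : Fin k → ℕ) (h : Fin (blockSize k w) → ℕ) →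
                sumFin (blockSize k w) h ≡ sumFin k (λ a → sumFin (w a) (λ i → h (encode k w a i)))
sumFin-blocks zero    w h = refl
sumFin-blocks (suc k) w h =
  trans (sumFin-↑ (w zero) (blockSize k (λ a → w (suc a))) h)
        (cong (sumFin (w zero) (λ i → h (encode (suc k) w zero i)) +_)
              (sumFin-blocks k (λ a → w (suc a)) (λ j → h (w zero ↑ʳ j))))

cycEdge-≤ : ∀ {m} k (c : Fin k → Fin m) {i j : Fin k} →
            suc (toℕ i) ≡ toℕ j ⊎ (suc (toℕ i) ≡ k × toℕ j ≡ 0) →
            EdgeOK (cycEdge k i j) (c i) (c j) → c i ≤ c j
cycEdge-≤ k c {i} {j} step ok with i ≟ j
... | yes refl = Finₚ.≤-refl
... | no _ with suc (toℕ i) ℕₚ.≟ toℕ j | suc (toℕ i) ℕₚ.≟ k | toℕ j ℕₚ.≟ 0 | step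
...   | yes _ | _     | _     | _             = ok
...   | no _  | yes _ | yes _ | _             = ok
...   | no ¬e | _     | _     | inj₁ e        = ⊥-elim (¬e e)
...   | no _  | no ¬e | _     | inj₂ (e , _)  = ⊥-elim (¬e e)
...   | no _  | yes _ | no ¬e | inj₂ (_ , e)  = ⊥-elim (¬e e)

constant-ProperD-C : ∀ {m} k (c : Fin m) → ProperD (C k) (λ _ → c)
constant-ProperD-C k c i j with i ≟ j
... | yes _ = tt
... | no _ with suc (toℕ i) ℕₚ.≟ toℕ j | suc (toℕ i) ℕₚ.≟ k | toℕ j ℕₚ.≟ 0
...   | yes _ | _     | _     = Finₚ.≤-refl
...   | no _  | yes _ | yes _ = Finₚ.≤-refl
...   | no _  | yes _ | no _  = tt
...   | no _  | no _  | _     = tt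

≤-along-path : ∀ {m k} (c : Fin (suc k) → Fin m) → (∀ (i : Fin k) → c (inject₁ i) ≤ c (suc i)) →
               ∀ i → c zero ≤ c i × c i ≤ c (fromℕ k)
≤-along-path {k = zero}  c step zero    = Finₚ.≤-refl , Finₚ.≤-refl
≤-along-path {k = suc k} c step zero    =
  Finₚ.≤-refl , Finₚ.≤-trans (step zero) (proj₂ (≤-along-path (λ j → c (suc j)) (λ j → step (suc j)) zero))
≤-along-path {k = suc k} c step (suc i) =
  Finₚ.≤-trans (step zero) (proj₁ rest) , proj₂ rest
  where rest = ≤-along-path (λ j → c (suc j)) (λ j → step (suc j)) i

ProperD-C-constant : ∀ {m} k (c : Fin k → Fin m) → ProperD (C k) c → ∀ i j → c i ≡ c j
ProperD-C-constant (suc k) c proper i j = trans (≡c₀ i) (≡.sym (≡c₀ j))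
  where
  around : ∀ i → c zero ≤ c i × c i ≤ c (fromℕ k)
  around = ≤-along-path c (λ i → cycEdge-≤ (suc k) c (inj₁ (cong suc (Finₚ.toℕ-inject₁ i)))
                                                      (proper (inject₁ i) (suc i)))
  closing : c (fromℕ k) ≤ c zero
  closing = cycEdge-≤ (suc k) c (inj₂ (cong suc (Finₚ.toℕ-fromℕ k) , refl)) (proper (fromℕ k) zero)
  ≡c₀ : ∀ i → c i ≡ c zero
  ≡c₀ i = Finₚ.≤-antisym (Finₚ.≤-trans (proj₂ (around i)) closing) (proj₁ (around i))

ProperW-resp : ∀ H {m} {κ κ′ : Fin (n H) → Fin m} → κ ≗ κ′ → ProperW H κ → ProperW H κ′
ProperW-resp H e proper a b ab κ′a≡κ′b = proper a b ab (trans (e a) (trans κ′a≡κ′b (≡.sym (e b))))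

ProperD-resp : ∀ G {m} {ν ν′ : Fin (N G) → Fin m} → ν ≗ ν′ → ProperD G ν → ProperD G ν′
ProperD-resp G e proper x y = subst₂ (EdgeOK (edge G x y)) (e x) (e y) (proper x y)

wexp-cong : ∀ H {m} {κ κ′ : Fin (n H) → Fin m} → κ ≗ κ′ → wexp H κ ≗ wexp H κ′
wexp-cong H e i = sumFin-cong (n H) (λ a → cong (λ c → if does (c ≟ i) then wt H a else 0) (e a))

dexp-cong : ∀ G {m} {ν ν′ : Fin (N G) → Fin m} → ν ≗ ν′ → dexp G ν ≗ dexp G ν′
dexp-cong G e i = sumFin-cong (N G) (λ x → cong (λ c → if does (c ≟ i) then 1 else 0) (e x))

ProperWOfContent : (H : WeightedGraph) {m : ℕ} → (Fin m → ℕ) → (Fin (n H) → Fin m) → Set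
ProperWOfContent H α κ = ProperW H κ × wexp H κ ≗ α

ProperDOfContent : (G : ECDigraph) {m : ℕ} → (Fin m → ℕ) → (Fin (N G) → Fin m) → Set
ProperDOfContent G α ν = ProperD G ν × dexp G ν ≗ α

ProperWOfContent-resp : ∀ H {m} {α : Fin m → ℕ} {κ κ′ : Fin (n H) → Fin m} →
                        κ ≗ κ′ → ProperWOfContent H α κ → ProperWOfContent H α κ′
ProperWOfContent-resp H e (proper , content) =
  ProperW-resp H e proper , λ c → trans (≡.sym (wexp-cong H e c)) (content c)

ProperDOfContent-resp : ∀ G {m} {α : Fin m → ℕ} {ν ν′ : Fin (N G) → Fin m} →
                        ν ≗ ν′ → ProperDOfContent G α ν → ProperDOfContent G α ν′
ProperDOfContent-resp G e (proper , content) =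
  ProperD-resp G e proper , λ c → trans (≡.sym (dexp-cong G e c)) (content c)

module BlownUp (H : WeightedGraph) (v : (a : Fin (n H)) → Fin (wt H a)) where

  G : ECDigraph
  G = GOf H v

  block : (a : Fin (n H)) → Fin (wt H a) → Fin (N G)
  block = encode (n H) (wt H)

  owner : Fin (N G) → Fin (n H)
  owner x = proj₁ (decode (n H) (wt H) x)

  owner-block : ∀ a i → owner (block a i) ≡ a
  owner-block a i = cong proj₁ (decode-encode (n H) (wt H) a i)

  spread : ∀ {m} → (Fin (n H) → Fin m) → Fin (N G) → Fin m
  spread κ x = κ (owner x)

  pick : ∀ {m} → (Fin (N G) → Fin m) → Fin (n H) → Fin m
  pick ν a = ν (block a (v a))

  edge-within : ∀ a i j → edge G (block a i) (block a j) ≡ cycEdge (wt H a) i j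
  edge-within a i j
    rewrite decode-encode (n H) (wt H) a i | decode-encode (n H) (wt H) a j with a ≟ a
  ... | yes refl = refl
  ... | no a≢a   = ⊥-elim (a≢a refl)

  edge-between : ∀ a b → a < b → adj H a b ≡ true →
                 edge G (block a (v a)) (block b (v b)) ≡ just dashed
  edge-between a b a<b ab
    rewrite decode-encode (n H) (wt H) a (v a) | decode-encode (n H) (wt H) b (v b) with a ≟ b
  ... | yes refl = ⊥-elim (Finₚ.<-irrefl refl a<b)
  ... | no _ rewrite ab with a Finₚ.<? b | v a ≟ v a | v b ≟ v b
  ...   | yes _  | yes _ | yes _ = refl
  ...   | no a≮b | _     | _     = ⊥-elim (a≮b a<b)
  ...   | yes _  | no ¬e | _     = ⊥-elim (¬e refl)
  ...   | yes _  | yes _ | no ¬e = ⊥-elim (¬e refl)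

  spread-proper : ∀ {m} (κ : Fin (n H) → Fin m) → ProperW H κ → ProperD G (spread κ)
  spread-proper κ proper x y with decode (n H) (wt H) x | decode (n H) (wt H) y
  ... | a , i | b , j with a ≟ b
  ...   | yes refl = constant-ProperD-C (wt H a) (κ a) i j
  ...   | no _ with adj H a b in ab | a Finₚ.<? b | i ≟ v a | j ≟ v b
  ...     | true  | yes _ | yes _ | yes _ = proper a b ab
  ...     | true  | yes _ | yes _ | no _  = tt
  ...     | true  | yes _ | no _  | _     = tt
  ...     | true  | no _  | _     | _     = tt
  ...     | false | _     | _     | _     = tt

  pick-separates : ∀ {m} (ν : Fin (N G) → Fin m) → ProperD G ν →
                   ∀ a b → a < b → adj H a b ≡ true → pick ν a ≢ pick ν b
  pick-separates ν proper a b a<b ab =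
    subst (λ e → EdgeOK e (pick ν a) (pick ν b)) (edge-between a b a<b ab)
          (proper (block a (v a)) (block b (v b)))

  pick-proper : ∀ {m} (ν : Fin (N G) → Fin m) → ProperD G ν → ProperW H (pick ν)
  pick-proper ν proper a b ab with Finₚ.<-cmp a b
  ... | tri< a<b _ _  = pick-separates ν proper a b a<b ab
  ... | tri≈ _ refl _ with () ← trans (≡.sym ab) (irrefl H a)
  ... | tri> _ _ b<a  = λ e → pick-separates ν proper b a b<a (trans (sym H b a) ab) (≡.sym e)

  pick-spread : ∀ {m} (κ : Fin (n H) → Fin m) → pick (spread κ) ≗ κ
  pick-spread κ a = cong κ (owner-block a (v a))

  spread-pick : ∀ {m} (ν : Fin (N G) → Fin m) → ProperD G ν → spread (pick ν) ≗ ν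
  spread-pick ν proper x = begin
    ν (block a (v a))  ≡⟨ ProperD-C-constant (wt H a) (λ i → ν (block a i)) properOnBlock (v a) i ⟩
    ν (block a i)      ≡⟨ cong ν (encode-decode (n H) (wt H) x) ⟩
    ν x                ∎
    where
    a = owner x
    i = proj₂ (decode (n H) (wt H) x)
    properOnBlock : ProperD (C (wt H a)) (λ i → ν (block a i))
    properOnBlock i j = subst (λ e → EdgeOK e (ν (block a i)) (ν (block a j)))
                                (edge-within a i j) (proper (block a i) (block a j))

  dexp-spread : ∀ {m} (κ : Fin (n H) → Fin m) → dexp G (spread κ) ≗ wexp H κ
  dexp-spread κ c = trans (sumFin-blocks (n H) (wt H) _) (sumFin-cong (n H) blockCount)
    where
    blockCount : ∀ a → sumFin (wt H a) (λ i → if does (κ (owner (block a i)) ≟ c) then 1 else 0)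
                       ≡ (if does (κ a ≟ c) then wt H a else 0)
    blockCount a = trans (sumFin-cong (wt H a) (λ i → cong (λ b → if does (κ b ≟ c) then 1 else 0)
                                                          (owner-block a i)))
                         (sumFin-indicator (wt H a) (does (κ a ≟ c)))

  spread-ofContent : ∀ {m} {α : Fin m → ℕ} (κ : Fin (n H) → Fin m) →
                     ProperWOfContent H α κ → ProperDOfContent G α (spread κ)
  spread-ofContent κ (proper , content) =
    spread-proper κ proper , λ c → trans (dexp-spread κ c) (content c)

  pick-ofContent : ∀ {m} {α : Fin m → ℕ} (ν : Fin (N G) → Fin m) →
                   ProperDOfContent G α ν → ProperWOfContent H α (pick ν)
  pick-ofContent ν (proper , content) = pick-proper ν proper , λ c → begin
    wexp H (pick ν) c           ≡⟨ dexp-spread (pick ν) c ⟨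
    dexp G (spread (pick ν)) c  ≡⟨ dexp-cong G (spread-pick ν proper) c ⟩
    dexp G ν c                  ≡⟨ content c ⟩
    _                           ∎

mainTheorem7 : (H : WeightedGraph) (v : (a : Fin (n H)) → Fin (wt H a)) →
               (m : ℕ) (α : Fin m → ℕ) →
               coeffX H m α ≡ coeff𝒳 (GOf H v) m α
mainTheorem7 H v m α =
  CountingByBijection.countMaps-≡ _ _ spread pick
    (ProperWOfContent-resp H) (ProperDOfContent-resp G)
    (λ e x → e (owner x)) (λ e a → e (block a (v a)))
    (spread-ofContent _) (pick-ofContent _)
    (λ {κ} _ → pick-spread κ) (λ {ν} (proper , _) → spread-pick ν proper)
  where open BlownUp H v
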